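{- Let $p,q\ge1$, $n=p+q$, and let $\gamma,\tau$ be $(p,q)$-clans. Then $\gamma(i;+)\ge\tau(i;+)$ for all $i\in\{1,\ldots,n\}$ if and only if $u_\gamma\ge u_\tau$ in Bruhat order; and $\gamma(i;-)\ge\tau(i;-)$ for all $i\in\{1,\ldots,n\}$ if and only if $v_\gamma\ge v_\tau$ in Bruhat order.
   Context: A $(p,q)$-clan has nodes $1,\ldots,n$, pairwise disjoint pairs $(i,j)$, $i<j$ (arcs; $i$ left endpoint, $j$ right endpoint), and a sign $\pm$ on each other node, with $\#\{+\}-\#\{ -\}=p-q$. $\gamma(i;+)$ is the number of $+$ nodes among the first $i$ nodes plus the number of arcs with both endpoints among the first $i$ nodes; $\gamma(i;-)$ is defined likewise with $-$. $v_\gamma\in S_n$: label nodes that are $+$ or left endpoints by $1,\ldots,p$ left to right, nodes that are $-$ or right endpoints by $p+1,\ldots,n$; $v_\gamma(i)$ = label of node $i$. $u_\gamma$: label nodes that are $-$ or left endpoints by $1,\ldots,q$ left to right, nodes that are $+$ or right endpoints by $q+1,\ldots,n$; $u_\gamma(i)$ = label of node $i$. -}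

module Defs where

open import Data.Nat using (ℕ; zero; suc; _+_; _<_; _≤_; _<ᵇ_; _≡ᵇ_)
open import Data.Integer as ℤ using (ℤ; +_)
open import Data.Fin using (Fin; toℕ)
open import Data.Bool using (Bool; true; false; _∧_; _∨_; not; if_then_else_)
open import Data.Vec using (Vec; tabulate; lookup; countᵇ; allFin; sum; map)
open import Data.Fin.Permutation.Components using (transpose)
open import Relation.Binary.PropositionalEquality using (_≡_)

-- Signs of nodes not on arcs: true = '+', false = '-'.
-- A (p,q)-clan on nodes 0..n-1 (n = p+q; node k here is node k+1 of the paper):
-- σ is an involution; its 2-cycles {i, σ i} are the arcs, its fixed points the
-- signed nodes, with sign 'sgn i' (sgn is ignored on arc endpoints).
record Clan (p q : ℕ) : Set where
  field
    σ      : Fin (p + q) → Fin (p + q)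
    invol  : ∀ i → σ (σ i) ≡ i
    sgn    : Fin (p + q) → Bool
    balance : (+ countᵇ (λ i → (toℕ (σ i) ≡ᵇ toℕ i) ∧ sgn i) (allFin (p + q)))
              ℤ.- (+ countᵇ (λ i → (toℕ (σ i) ≡ᵇ toℕ i) ∧ not (sgn i)) (allFin (p + q)))
              ≡ (+ p) ℤ.- (+ q)

module _ {p q : ℕ} (γ : Clan p q) where
  open Clan γ

  isPlus isMinus isLeft isRight : Fin (p + q) → Bool
  isPlus  i = (toℕ (σ i) ≡ᵇ toℕ i) ∧ sgn i
  isMinus i = (toℕ (σ i) ≡ᵇ toℕ i) ∧ not (sgn i)
  isLeft  i = toℕ i <ᵇ toℕ (σ i)
  isRight i = toℕ (σ i) <ᵇ toℕ i

  inFirst : ℕ → Fin (p + q) → Bool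
  inFirst i k = toℕ k <ᵇ i

  γ⁺ : ℕ → ℕ
  γ⁺ i = countᵇ (λ k → inFirst i k ∧ isPlus k) (allFin (p + q))
       + countᵇ (λ k → isLeft k ∧ inFirst i k ∧ inFirst i (σ k)) (allFin (p + q))

  γ⁻ : ℕ → ℕ
  γ⁻ i = countᵇ (λ k → inFirst i k ∧ isMinus k) (allFin (p + q))
       + countᵇ (λ k → isLeft k ∧ inFirst i k ∧ inFirst i (σ k)) (allFin (p + q))

  rank : (Fin (p + q) → Bool) → Fin (p + q) → ℕ
  rank P i = countᵇ (λ k → (toℕ k <ᵇ suc (toℕ i)) ∧ P k) (allFin (p + q))

  -- one-line notations (values in 1..n)
  vγ : Vec ℕ (p + q)
  vγ = tabulate λ i → if isPlus i ∨ isLeft i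
                      then rank (λ k → isPlus k ∨ isLeft k) i
                      else p + rank (λ k → isMinus k ∨ isRight k) i

  uγ : Vec ℕ (p + q)
  uγ = tabulate λ i → if isMinus i ∨ isLeft i
                      then rank (λ k → isMinus k ∨ isLeft k) i
                      else q + rank (λ k → isPlus k ∨ isRight k) i

-- Permutations of S_n in one-line notation w = (w(1),...,w(n)).
-- Length ℓ(w) = number of inversions.
ℓ : ∀ {n} → Vec ℕ n → ℕ
ℓ {n} w = sum (map (λ a → countᵇ (λ b → (toℕ a <ᵇ toℕ b) ∧ (lookup w b <ᵇ lookup w a)) (allFin n)) (allFin n))

-- w·(i j): right multiplication by the transposition (i j), i.e. swap positions i, j
_·⟨_,_⟩ : ∀ {n} → Vec ℕ n → Fin n → Fin n → Vec ℕ n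
w ·⟨ i , j ⟩ = tabulate λ k → lookup w (transpose i j k)

data _≤B_ {n : ℕ} (u : Vec ℕ n) : Vec ℕ n → Set where
  ≤B-refl : u ≤B u
  ≤B-step : ∀ {w} → u ≤B w → (i j : Fin n) → ℓ w < ℓ (w ·⟨ i , j ⟩) → u ≤B (w ·⟨ i , j ⟩)

{-# OPTIONS --safe #-}
-- The one-line notation u_γ puts 1, …, q, from left to right, on the nodes that are − or left
-- endpoints and q+1, …, n on the others, so it is the shuffle given by a Boolean word; and
-- γ(i;+) = i − #{k ≤ i : k is − or a left endpoint}, since an arc inside the first i nodes is
-- counted exactly once, at its right endpoint.  The theorem thus becomes the description of the
-- Bruhat order on such shuffles by dominance of prefix counts.  A length-increasing transposition
-- swaps an ascent, so it never moves a small value to the left.  Conversely, while one word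
-- strictly dominates the other, the last true of the run starting at their first difference can
-- move one step to the right, an adjacent length-increasing transposition that keeps the dominance
-- and lowers the sum of the prefix counts.  Exchanging + and − gives the statement for v_γ.
module Submission where

open import Defs
open import Data.Nat
open import Data.Nat.Properties
open import Algebra.Properties.CommutativeMonoid.Sum +-0-commutativeMonoid
  using (sum; sum-cong-≗; ∑-distrib-+; sum-permute)
open import Algebra.Properties.CommutativeSemigroup +-commutativeSemigroup using (xy∙z≈zy∙x)
open import Data.Bool using (Bool; true; false; _∧_; _∨_; not; if_then_else_; T)
import Data.Bool as Bool
open import Data.Empty using (⊥-elim)
open import Data.Fin as Fin using (Fin; zero; suc; toℕ)
import Data.Fin.Properties as Fin
open import Data.Fin.Permutation using (permutation)
open import Data.Fin.Permutation.Components using (transpose; transpose-inverse)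
import Data.Integer as ℤ
import Data.Integer.Properties as ℤ
open import Data.Integer.Tactic.RingSolver using () renaming (solve-∀ to ℤ-solve-∀)
open import Data.Nat.Induction using (<-wellFounded)
open import Data.Nat.Tactic.RingSolver using (solve-∀)
open import Data.Product using (Σ-syntax; _×_; _,_)
open import Data.Unit using (tt)
open import Data.Vec as Vec using (Vec; []; _∷_; tabulate; lookup; countᵇ; allFin; map; _[_]≔_)
open import Data.Vec.Properties
  using (≡-dec; tabulate∘lookup; tabulate-cong; lookup∘tabulate; tabulate-allFin; lookup∘update; lookup∘update′)
open import Function using (_∘_; id)
open import Function.Bundles using (_⇔_; mk⇔)
open import Function.Construct.Composition using (_⇔-∘_)
open import Function.Construct.Symmetry using (⇔-sym)
open import Induction.WellFounded using (Acc; acc)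
open import Relation.Binary using (tri<; tri≈; tri>)
open import Relation.Binary.PropositionalEquality
open import Relation.Nullary using (does; yes; no; ¬_; Dec)
open import Relation.Nullary.Decidable using (dec-true; dec-false; T?)

private variable
  A : Set
  n : ℕ

-- Counting

𝟙 : Bool → ℕ
𝟙 true  = 1
𝟙 false = 0

T⇒≡true : ∀ {b} → T b → b ≡ true
T⇒≡true = dec-true (T? _)

¬T⇒≡false : ∀ {b} → ¬ T b → b ≡ false
¬T⇒≡false = dec-false (T? _)

𝟙-mono : ∀ {b c} → (T b → T c) → 𝟙 b ≤ 𝟙 c
𝟙-mono {false}         _   = z≤n
𝟙-mono {true}  {true}  _   = ≤-refl
𝟙-mono {true}  {false} b⇒c = ⊥-elim (b⇒c tt)

𝟙≤1 : ∀ b → 𝟙 b ≤ 1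
𝟙≤1 b = 𝟙-mono {b} {true} (λ _ → tt)

count : (Fin n → Bool) → ℕ
count P = sum (𝟙 ∘ P)

count-cong : {P Q : Fin n → Bool} → P ≗ Q → count P ≡ count Q
count-cong P≗Q = sum-cong-≗ (cong 𝟙 ∘ P≗Q)

count-permute : (f g : Fin n → Fin n) → (∀ k → f (g k) ≡ k) → (∀ k → g (f k) ≡ k) →
                (P : Fin n → Bool) → count (P ∘ f) ≡ count P
count-permute f g fg gf P = sym (sum-permute (𝟙 ∘ P) (permutation f g fg gf))

count-true : count {n} (λ _ → true) ≡ n
count-true {zero}  = refl
count-true {suc n} = cong suc count-true

count-+ : {X Y Z : Fin n → Bool} → (∀ k → 𝟙 (Z k) ≡ 𝟙 (X k) + 𝟙 (Y k)) → count Z ≡ count X + count Y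
count-+ {X = X} {Y} Z≡X+Y = trans (sum-cong-≗ Z≡X+Y) (∑-distrib-+ (𝟙 ∘ X) (𝟙 ∘ Y))

count-+₃ : {X Y Z W : Fin n → Bool} → (∀ k → 𝟙 (X k) + 𝟙 (Y k) + 𝟙 (Z k) ≡ 𝟙 (W k)) →
           count X + count Y + count Z ≡ count W
count-+₃ {X = X} {Y} {Z} {W} X+Y+Z≡W = begin
  count X + count Y + count Z                 ≡⟨ cong (_+ count Z) (∑-distrib-+ (𝟙 ∘ X) (𝟙 ∘ Y)) ⟨
  sum (λ k → 𝟙 (X k) + 𝟙 (Y k)) + count Z    ≡⟨ ∑-distrib-+ (λ k → 𝟙 (X k) + 𝟙 (Y k)) (𝟙 ∘ Z) ⟨
  sum (λ k → 𝟙 (X k) + 𝟙 (Y k) + 𝟙 (Z k))    ≡⟨ sum-cong-≗ X+Y+Z≡W ⟩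
  count W                                     ∎
  where open ≡-Reasoning

sum-mono-≤ : {f g : Fin n → ℕ} → (∀ k → f k ≤ g k) → sum f ≤ sum g
sum-mono-≤ {n = zero}  f≤g = z≤n
sum-mono-≤ {n = suc n} f≤g = +-mono-≤ (f≤g zero) (sum-mono-≤ (f≤g ∘ suc))

sum-mono-< : {f g : Fin n → ℕ} → (∀ k → f k ≤ g k) → (i : Fin n) → f i < g i → sum f < sum g
sum-mono-< f≤g zero    fi<gi = +-mono-<-≤ fi<gi (sum-mono-≤ (f≤g ∘ suc))
sum-mono-< f≤g (suc i) fi<gi = +-mono-≤-< (f≤g zero) (sum-mono-< (f≤g ∘ suc) i fi<gi)

sumᵛ-allFin : (g : Fin n → ℕ) → Vec.sum (map g (allFin n)) ≡ sum g
sumᵛ-allFin g = trans (cong Vec.sum (sym (tabulate-allFin g))) (sumᵛ-tabulate g)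
  where
  sumᵛ-tabulate : ∀ {n} (g : Fin n → ℕ) → Vec.sum (tabulate g) ≡ sum g
  sumᵛ-tabulate {zero}  g = refl
  sumᵛ-tabulate {suc n} g = cong (g zero +_) (sumᵛ-tabulate (g ∘ suc))

countPrefix : ℕ → (A → Bool) → Vec A n → ℕ
countPrefix zero    P xs       = 0
countPrefix (suc m) P []       = 0
countPrefix (suc m) P (x ∷ xs) = 𝟙 (P x) + countPrefix m P xs

countAll : (A → Bool) → Vec A n → ℕ
countAll {n = n} = countPrefix n

countAll-tabulate : (P : A → Bool) (f : Fin n → A) → countAll P (tabulate f) ≡ count (P ∘ f)
countAll-tabulate {n = zero}  P f = refl
countAll-tabulate {n = suc n} P f = cong (𝟙 (P (f zero)) +_) (countAll-tabulate P (f ∘ suc))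

countᵇ≡countAll : (P : A → Bool) (xs : Vec A n) → countᵇ P xs ≡ countAll P xs
countᵇ≡countAll P []       = refl
countᵇ≡countAll P (x ∷ xs) with P x
... | true  = cong suc (countᵇ≡countAll P xs)
... | false = countᵇ≡countAll P xs

countᵇ-allFin : (P : Fin n → Bool) → countᵇ P (allFin n) ≡ count P
countᵇ-allFin {n} P = trans (countᵇ≡countAll P (allFin n)) (countAll-tabulate P id)

countAll-lookup : (P : A → Bool) (xs : Vec A n) → count (P ∘ lookup xs) ≡ countAll P xs
countAll-lookup P xs = trans (sym (countAll-tabulate P (lookup xs))) (cong (countAll P) (tabulate∘lookup xs))

count-<-tabulate : ∀ m (P : A → Bool) (f : Fin n → A) →
                   count (λ k → (toℕ k <ᵇ m) ∧ P (f k)) ≡ countPrefix m P (tabulate f)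
count-<-tabulate {n = zero}  zero    P f = refl
count-<-tabulate {n = zero}  (suc m) P f = refl
count-<-tabulate {n = suc n} zero    P f = count-<-tabulate zero P (f ∘ suc)
count-<-tabulate {n = suc n} (suc m) P f = cong (𝟙 (P (f zero)) +_) (count-<-tabulate m P (f ∘ suc))

countPrefix-full : ∀ {m} (P : A → Bool) (xs : Vec A n) → n ≤ m → countPrefix m P xs ≡ countAll P xs
countPrefix-full {m = zero}  P []       _         = refl
countPrefix-full {m = suc m} P []       _         = refl
countPrefix-full {m = suc m} P (x ∷ xs) (s≤s n≤m) = cong (𝟙 (P x) +_) (countPrefix-full P xs n≤m)

countPrefix-suc : (P : A → Bool) (xs : Vec A n) (i : Fin n) →
                  countPrefix (suc (toℕ i)) P xs ≡ countPrefix (toℕ i) P xs + 𝟙 (P (lookup xs i))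
countPrefix-suc P (x ∷ xs) zero    = +-comm (𝟙 (P x)) 0
countPrefix-suc P (x ∷ xs) (suc i) =
  trans (cong (𝟙 (P x) +_) (countPrefix-suc P xs i)) (sym (+-assoc (𝟙 (P x)) _ _))

countPrefix-mono : ∀ m {P Q : A → Bool} → (∀ x → T (P x) → T (Q x)) → (xs : Vec A n) →
                   countPrefix m P xs ≤ countPrefix m Q xs
countPrefix-mono zero    P⇒Q xs       = z≤n
countPrefix-mono (suc m) P⇒Q []       = z≤n
countPrefix-mono (suc m) P⇒Q (x ∷ xs) = +-mono-≤ (𝟙-mono (P⇒Q x)) (countPrefix-mono m P⇒Q xs)

countPrefix-≤ : ∀ m (P : A → Bool) (xs : Vec A n) → countPrefix m P xs ≤ m
countPrefix-≤ zero    P xs       = z≤n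
countPrefix-≤ (suc m) P []       = z≤n
countPrefix-≤ (suc m) P (x ∷ xs) = +-mono-≤ (𝟙≤1 (P x)) (countPrefix-≤ m P xs)

countPrefix-[]≔-< : ∀ m (P : A → Bool) (xs : Vec A n) (j : Fin n) (a : A) → toℕ j < m →
                    countPrefix m P (xs [ j ]≔ a) + 𝟙 (P (lookup xs j)) ≡ countPrefix m P xs + 𝟙 (P a)
countPrefix-[]≔-< (suc m) P (x ∷ xs) zero    a _ = xy∙z≈zy∙x (𝟙 (P a)) _ (𝟙 (P x))
countPrefix-[]≔-< (suc m) P (x ∷ xs) (suc j) a (s≤s j<m) = begin
  𝟙 (P x) + countPrefix m P (xs [ j ]≔ a) + 𝟙 (P (lookup xs j))
    ≡⟨ +-assoc (𝟙 (P x)) _ _ ⟩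
  𝟙 (P x) + (countPrefix m P (xs [ j ]≔ a) + 𝟙 (P (lookup xs j)))
    ≡⟨ cong (𝟙 (P x) +_) (countPrefix-[]≔-< m P xs j a j<m) ⟩
  𝟙 (P x) + (countPrefix m P xs + 𝟙 (P a))
    ≡⟨ +-assoc (𝟙 (P x)) _ _ ⟨
  𝟙 (P x) + countPrefix m P xs + 𝟙 (P a) ∎
  where open ≡-Reasoning

countPrefix-[]≔-≥ : ∀ m (P : A → Bool) (xs : Vec A n) (j : Fin n) (a : A) → m ≤ toℕ j →
                    countPrefix m P (xs [ j ]≔ a) ≡ countPrefix m P xs
countPrefix-[]≔-≥ zero    P xs       j       a _          = refl
countPrefix-[]≔-≥ (suc m) P (x ∷ xs) (suc j) a (s≤s m≤j) = cong (𝟙 (P x) +_) (countPrefix-[]≔-≥ m P xs j a m≤j)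

countAll-[]≔ : (P : A → Bool) (xs : Vec A n) (j : Fin n) (a : A) →
               countAll P (xs [ j ]≔ a) + 𝟙 (P (lookup xs j)) ≡ countAll P xs + 𝟙 (P a)
countAll-[]≔ P xs j a = countPrefix-[]≔-< _ P xs j a (Fin.toℕ<n j)

countAfter : (A → Bool) → Vec A n → Fin n → ℕ
countAfter P (x ∷ xs) zero    = countAll P xs
countAfter P (x ∷ xs) (suc j) = countAfter P xs j

countAll-split : (P : A → Bool) (xs : Vec A n) (j : Fin n) →
                 countAll P xs ≡ countPrefix (toℕ j) P xs + (𝟙 (P (lookup xs j)) + countAfter P xs j)
countAll-split P (x ∷ xs) zero    = refl
countAll-split P (x ∷ xs) (suc j) =
  trans (cong (𝟙 (P x) +_) (countAll-split P xs j)) (sym (+-assoc (𝟙 (P x)) _ _))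

countAfter-[]≔ : (P : A → Bool) (xs : Vec A n) (j : Fin n) (a : A) → countAfter P (xs [ j ]≔ a) j ≡ countAfter P xs j
countAfter-[]≔ P (x ∷ xs) zero    a = refl
countAfter-[]≔ P (x ∷ xs) (suc j) a = countAfter-[]≔ P xs j a

countAll-[]≔-split : (P : A → Bool) (xs : Vec A n) (j : Fin n) (a : A) →
                     countAll P (xs [ j ]≔ a) ≡ countPrefix (toℕ j) P xs + (𝟙 (P a) + countAfter P xs j)
countAll-[]≔-split P xs j a = begin
  countAll P (xs [ j ]≔ a)
    ≡⟨ countAll-split P (xs [ j ]≔ a) j ⟩
  countPrefix (toℕ j) P (xs [ j ]≔ a) + (𝟙 (P (lookup (xs [ j ]≔ a) j)) + countAfter P (xs [ j ]≔ a) j)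
    ≡⟨ cong₂ (λ c x → c + (𝟙 (P x) + countAfter P (xs [ j ]≔ a) j))
             (countPrefix-[]≔-≥ (toℕ j) P xs j a ≤-refl) (lookup∘update j xs a) ⟩
  countPrefix (toℕ j) P xs + (𝟙 (P a) + countAfter P (xs [ j ]≔ a) j)
    ≡⟨ cong (λ c → countPrefix (toℕ j) P xs + (𝟙 (P a) + c)) (countAfter-[]≔ P xs j a) ⟩
  countPrefix (toℕ j) P xs + (𝟙 (P a) + countAfter P xs j) ∎
  where open ≡-Reasoning

-- Transpositions and inversions

lookup-ext : {u v : Vec A n} → (∀ k → lookup u k ≡ lookup v k) → u ≡ v
lookup-ext {u = u} {v} u≗v = trans (sym (tabulate∘lookup u)) (trans (tabulate-cong u≗v) (tabulate∘lookup v))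

transpose-suc : (i j k : Fin n) → transpose (suc i) (suc j) (suc k) ≡ suc (transpose i j k)
transpose-suc i j k with does (k Fin.≟ i)
... | true  = refl
... | false with does (k Fin.≟ j)
...   | true  = refl
...   | false = refl

transpose-same : (i k : Fin n) → transpose i i k ≡ k
transpose-same i k with k Fin.≟ i
... | yes k≡i = sym k≡i
... | no  k≢i rewrite dec-false (k Fin.≟ i) k≢i = refl

transpose-comm : (i j k : Fin n) → transpose i j k ≡ transpose j i k
transpose-comm i j k with k Fin.≟ i | k Fin.≟ j
... | yes refl | yes refl = refl
... | yes refl | no  _    rewrite dec-true (k Fin.≟ k) refl = refl
... | no  _    | yes refl rewrite dec-true (k Fin.≟ k) refl = refl
... | no  k≢i  | no  k≢j  rewrite dec-false (k Fin.≟ i) k≢i | dec-false (k Fin.≟ j) k≢j = refl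

·⟨suc,suc⟩ : (x : ℕ) (xs : Vec ℕ n) (i j : Fin n) → (x ∷ xs) ·⟨ suc i , suc j ⟩ ≡ x ∷ xs ·⟨ i , j ⟩
·⟨suc,suc⟩ x xs i j = cong (x ∷_) (tabulate-cong (cong (lookup (x ∷ xs)) ∘ transpose-suc i j))

·⟨zero,suc⟩ : (x : ℕ) (xs : Vec ℕ n) (j : Fin n) → (x ∷ xs) ·⟨ zero , suc j ⟩ ≡ lookup xs j ∷ xs [ j ]≔ x
·⟨zero,suc⟩ x xs j = cong (lookup xs j ∷_) (lookup-ext λ k → trans (lookup∘tabulate _ k) (entry k))
  where
  entry : ∀ k → lookup (x ∷ xs) (transpose zero (suc j) (suc k)) ≡ lookup (xs [ j ]≔ x) k
  entry k with k Fin.≟ j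
  ... | yes refl = sym (lookup∘update k xs x)
  ... | no  k≢j  = sym (lookup∘update′ k≢j xs x)

·⟨⟩-comm : (w : Vec ℕ n) (i j : Fin n) → w ·⟨ i , j ⟩ ≡ w ·⟨ j , i ⟩
·⟨⟩-comm w i j = tabulate-cong (cong (lookup w) ∘ transpose-comm i j)

·⟨⟩-same : (w : Vec ℕ n) (i : Fin n) → w ·⟨ i , i ⟩ ≡ w
·⟨⟩-same w i = trans (tabulate-cong (cong (lookup w) ∘ transpose-same i)) (tabulate∘lookup w)

·⟨⟩-involutive : (w : Vec ℕ n) (i j : Fin n) → w ·⟨ i , j ⟩ ·⟨ i , j ⟩ ≡ w
·⟨⟩-involutive w i j = lookup-ext λ k → begin
  lookup (w ·⟨ i , j ⟩ ·⟨ i , j ⟩) k          ≡⟨ lookup∘tabulate (lookup (w ·⟨ i , j ⟩) ∘ transpose i j) k ⟩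
  lookup (w ·⟨ i , j ⟩) (transpose i j k)     ≡⟨ lookup∘tabulate (lookup w ∘ transpose i j) (transpose i j k) ⟩
  lookup w (transpose i j (transpose i j k))  ≡⟨ cong (lookup w ∘ transpose i j) (transpose-comm i j k) ⟩
  lookup w (transpose i j (transpose j i k))  ≡⟨ cong (lookup w) (transpose-inverse i j) ⟩
  lookup w k                                  ∎
  where open ≡-Reasoning

countAll-·⟨⟩ : (P : ℕ → Bool) (w : Vec ℕ n) (i j : Fin n) → countAll P (w ·⟨ i , j ⟩) ≡ countAll P w
countAll-·⟨⟩ P w i j = begin
  countAll P (w ·⟨ i , j ⟩)          ≡⟨ countAll-tabulate P (lookup w ∘ transpose i j) ⟩
  count (P ∘ lookup w ∘ transpose i j) ≡⟨ count-permute (transpose i j) (transpose j i)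
                                             (λ _ → transpose-inverse i j) (λ _ → transpose-inverse j i) (P ∘ lookup w) ⟩
  count (P ∘ lookup w)                 ≡⟨ countAll-lookup P w ⟩
  countAll P w                         ∎
  where open ≡-Reasoning

inversions : Vec ℕ n → ℕ
inversions []       = 0
inversions (x ∷ xs) = countAll (_<ᵇ x) xs + inversions xs

ℓ≡inversions : (w : Vec ℕ n) → ℓ w ≡ inversions w
ℓ≡inversions {n} w = begin
  ℓ w                                          ≡⟨ sumᵛ-allFin (λ a → countᵇ (inverted a) (allFin n)) ⟩
  sum (λ a → countᵇ (inverted a) (allFin n))   ≡⟨ sum-cong-≗ (countᵇ-allFin ∘ inverted) ⟩
  sum (count ∘ inverted)                       ≡⟨ inversionPairs w ⟩
  inversions w                                 ∎
  where
  open ≡-Reasoning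
  inverted : Fin n → Fin n → Bool
  inverted a b = (toℕ a <ᵇ toℕ b) ∧ (lookup w b <ᵇ lookup w a)
  inversionPairs : ∀ {n} (w : Vec ℕ n) →
    sum (λ a → count (λ b → (toℕ a <ᵇ toℕ b) ∧ (lookup w b <ᵇ lookup w a))) ≡ inversions w
  inversionPairs []       = refl
  inversionPairs (x ∷ xs) = cong₂ _+_ (countAll-lookup (_<ᵇ x) xs) (inversionPairs xs)

crossings : ℕ → Vec ℕ n → Fin n → ℕ
crossings a xs j = countPrefix (toℕ j) (a <ᵇ_) xs + countAfter (_<ᵇ a) xs j

-- the number of inversions not involving position j does not depend on the entry at j
inversions-[]≔ : (xs : Vec ℕ n) (j : Fin n) (a : ℕ) →
                 inversions xs + crossings a xs j ≡ inversions (xs [ j ]≔ a) + crossings (lookup xs j) xs j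
inversions-[]≔ (x ∷ xs) zero    a = xy∙z≈zy∙x (countAll (_<ᵇ x) xs) (inversions xs) (countAll (_<ᵇ a) xs)
inversions-[]≔ (x ∷ xs) (suc j) a = begin
  c + i + (g + p + q)      ≡⟨ regroup c i g p q ⟩
  (c + g) + (i + (p + q))  ≡⟨ cong₂ _+_ (sym (countAll-[]≔ (_<ᵇ x) xs j a)) (inversions-[]≔ xs j a) ⟩
  (c′ + g′) + (i′ + (p′ + q′)) ≡⟨ regroup c′ i′ g′ p′ q′ ⟨
  c′ + i′ + (g′ + p′ + q′) ∎
  where
  open ≡-Reasoning
  c i g p q c′ i′ g′ p′ q′ : ℕ
  c = countAll (_<ᵇ x) xs
  i = inversions xs
  g = 𝟙 (a <ᵇ x)
  p = countPrefix (toℕ j) (a <ᵇ_) xs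
  q = countAfter (_<ᵇ a) xs j
  c′ = countAll (_<ᵇ x) (xs [ j ]≔ a)
  i′ = inversions (xs [ j ]≔ a)
  g′ = 𝟙 (lookup xs j <ᵇ x)
  p′ = countPrefix (toℕ j) (lookup xs j <ᵇ_) xs
  q′ = countAfter (_<ᵇ lookup xs j) xs j
  regroup : ∀ c i g p q → c + i + (g + p + q) ≡ (c + g) + (i + (p + q))
  regroup = solve-∀

inversions-swap-< : (w : Vec ℕ n) (i j : Fin n) → toℕ i < toℕ j → lookup w j < lookup w i →
                    inversions (w ·⟨ i , j ⟩) < inversions w
inversions-swap-< (x ∷ xs) (suc i) (suc j) (s≤s i<j) wj<wi = begin-strict
  inversions ((x ∷ xs) ·⟨ suc i , suc j ⟩)              ≡⟨ cong inversions (·⟨suc,suc⟩ x xs i j) ⟩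
  countAll (_<ᵇ x) (xs ·⟨ i , j ⟩) + inversions (xs ·⟨ i , j ⟩) ≡⟨ cong (_+ _) (countAll-·⟨⟩ (_<ᵇ x) xs i j) ⟩
  countAll (_<ᵇ x) xs + inversions (xs ·⟨ i , j ⟩)      <⟨ +-monoʳ-< _ (inversions-swap-< xs i j i<j wj<wi) ⟩
  countAll (_<ᵇ x) xs + inversions xs                   ∎
  where open ≤-Reasoning
-- By inversions-[]≔ only the crossings of the two moved entries matter; as b < a, no more earlier
-- entries lie below b than below a, no fewer lie above b than above a, and the pair (a, b) is lost.
inversions-swap-< {suc n} (a ∷ xs) zero (suc j) _ b<a = begin-strict
  inversions ((a ∷ xs) ·⟨ zero , suc j ⟩)   ≡⟨ cong inversions (·⟨zero,suc⟩ a xs j) ⟩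
  countAll (_<ᵇ b) xs′ + inversions xs′     ≡⟨ cong (_+ inversions xs′) (countAll-[]≔-split (_<ᵇ b) xs j a) ⟩
  Lb + (𝟙 (a <ᵇ b) + Pb) + inversions xs′   ≡⟨ cong (λ z → Lb + (𝟙 z + Pb) + inversions xs′) a≮b ⟩
  Lb + Pb + inversions xs′                  <⟨ +-cancelʳ-< Gb _ _ drop ⟩
  La + (1 + Pa) + inversions xs             ≡⟨ cong (λ z → La + (𝟙 z + Pa) + inversions xs) b<ᵇa ⟨
  La + (𝟙 (b <ᵇ a) + Pa) + inversions xs    ≡⟨ cong (_+ inversions xs) (countAll-split (_<ᵇ a) xs j) ⟨
  countAll (_<ᵇ a) xs + inversions xs       ∎
  where
  open ≤-Reasoning
  b Lb La Ga Gb Pb Pa X Y : ℕ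
  b  = lookup xs j
  xs′ : Vec ℕ n
  xs′ = xs [ j ]≔ a
  Lb = countPrefix (toℕ j) (_<ᵇ b) xs
  La = countPrefix (toℕ j) (_<ᵇ a) xs
  Ga = countPrefix (toℕ j) (a <ᵇ_) xs
  Gb = countPrefix (toℕ j) (b <ᵇ_) xs
  Pb = countAfter (_<ᵇ b) xs j
  Pa = countAfter (_<ᵇ a) xs j
  X  = inversions xs′
  Y  = inversions xs
  a≮b : (a <ᵇ b) ≡ false
  a≮b = ¬T⇒≡false (<⇒≯ b<a ∘ <ᵇ⇒< a b)
  b<ᵇa : (b <ᵇ a) ≡ true
  b<ᵇa = T⇒≡true (<⇒<ᵇ b<a)
  Lb≤La : Lb ≤ La
  Lb≤La = countPrefix-mono (toℕ j) (λ y y<b → <⇒<ᵇ (<-trans (<ᵇ⇒< y b y<b) b<a)) xs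
  Ga≤Gb : Ga ≤ Gb
  Ga≤Gb = countPrefix-mono (toℕ j) (λ y a<y → <⇒<ᵇ (<-trans b<a (<ᵇ⇒< a y a<y))) xs
  drop : Lb + Pb + X + Gb < La + (1 + Pa) + Y + Gb
  drop = begin-strict
    Lb + Pb + X + Gb            ≡⟨ regroup₁ Lb Pb X Gb ⟩
    Lb + (X + (Gb + Pb))        ≡⟨ cong (Lb +_) (inversions-[]≔ xs j a) ⟨
    Lb + (Y + (Ga + Pa))        ≤⟨ +-mono-≤ Lb≤La (+-monoʳ-≤ Y (+-monoˡ-≤ Pa Ga≤Gb)) ⟩
    La + (Y + (Gb + Pa))        <⟨ n<1+n _ ⟩
    suc (La + (Y + (Gb + Pa)))  ≡⟨ regroup₂ La Y Gb Pa ⟩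
    La + (1 + Pa) + Y + Gb      ∎
    where
    regroup₁ : ∀ l p x g → l + p + x + g ≡ l + (x + (g + p))
    regroup₁ = solve-∀
    regroup₂ : ∀ l y g p → suc (l + (y + (g + p))) ≡ l + (1 + p) + y + g
    regroup₂ = solve-∀

-- Bruhat order and prefix counts

≤B-trans : {u v w : Vec ℕ n} → u ≤B v → v ≤B w → u ≤B w
≤B-trans u≤v ≤B-refl               = u≤v
≤B-trans u≤v (≤B-step v≤w i j ℓ<) = ≤B-step (≤B-trans u≤v v≤w) i j ℓ<

ℓ-<-·⟨⟩⇒ascent : (w : Vec ℕ n) (i j : Fin n) → toℕ i < toℕ j → ℓ w < ℓ (w ·⟨ i , j ⟩) →
                 lookup w i ≤ lookup w j
ℓ-<-·⟨⟩⇒ascent w i j i<j ℓ< = ≮⇒≥ λ wj<wi →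
  <-asym ℓ< (subst₂ _<_ (sym (ℓ≡inversions (w ·⟨ i , j ⟩))) (sym (ℓ≡inversions w))
                       (inversions-swap-< w i j i<j wj<wi))

countPrefix-·⟨⟩ : ∀ m (P : ℕ → Bool) (w : Vec ℕ n) (i j : Fin n) → toℕ i < toℕ j →
                  (T (P (lookup w j)) → T (P (lookup w i))) → countPrefix m P (w ·⟨ i , j ⟩) ≤ countPrefix m P w
countPrefix-·⟨⟩ zero    P w        i       j       _         _       = z≤n
countPrefix-·⟨⟩ (suc m) P (x ∷ xs) (suc i) (suc j) (s≤s i<j) Pj⇒Pi =
  subst (λ v → countPrefix (suc m) P v ≤ countPrefix (suc m) P (x ∷ xs)) (sym (·⟨suc,suc⟩ x xs i j))
        (+-monoʳ-≤ (𝟙 (P x)) (countPrefix-·⟨⟩ m P xs i j i<j Pj⇒Pi))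
countPrefix-·⟨⟩ (suc m) P (a ∷ xs) zero    (suc j) _         Pj⇒Pi =
  subst (λ v → countPrefix (suc m) P v ≤ countPrefix (suc m) P (a ∷ xs)) (sym (·⟨zero,suc⟩ a xs j))
        (head-swap (toℕ j <? m))
  where
  b : ℕ
  b = lookup xs j
  head-swap : Dec (toℕ j < m) → 𝟙 (P b) + countPrefix m P (xs [ j ]≔ a) ≤ 𝟙 (P a) + countPrefix m P xs
  head-swap (yes j<m) = ≤-reflexive (trans (+-comm (𝟙 (P b)) _)
                                            (trans (countPrefix-[]≔-< m P xs j a j<m) (+-comm _ (𝟙 (P a)))))
  head-swap (no  j≮m) = +-mono-≤ (𝟙-mono Pj⇒Pi) (≤-reflexive (countPrefix-[]≔-≥ m P xs j a (≮⇒≥ j≮m)))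

countPrefix-≤ᵇ-ascent : ∀ m t (w : Vec ℕ n) (i j : Fin n) → toℕ i < toℕ j → ℓ w < ℓ (w ·⟨ i , j ⟩) →
                        countPrefix m (_≤ᵇ t) (w ·⟨ i , j ⟩) ≤ countPrefix m (_≤ᵇ t) w
countPrefix-≤ᵇ-ascent m t w i j i<j ℓ< = countPrefix-·⟨⟩ m (_≤ᵇ t) w i j i<j λ wj≤t →
  ≤⇒≤ᵇ (≤-trans (ℓ-<-·⟨⟩⇒ascent w i j i<j ℓ<) (≤ᵇ⇒≤ (lookup w j) t wj≤t))

countPrefix-≤ᵇ-step : ∀ m t (w : Vec ℕ n) (i j : Fin n) → ℓ w < ℓ (w ·⟨ i , j ⟩) →
                      countPrefix m (_≤ᵇ t) (w ·⟨ i , j ⟩) ≤ countPrefix m (_≤ᵇ t) w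
countPrefix-≤ᵇ-step m t w i j ℓ< with Fin.<-cmp i j
... | tri< i<j _ _  = countPrefix-≤ᵇ-ascent m t w i j i<j ℓ<
... | tri≈ _ refl _ = ⊥-elim (<-irrefl (cong ℓ (sym (·⟨⟩-same w i))) ℓ<)
... | tri> _ _ j<i rewrite ·⟨⟩-comm w i j = countPrefix-≤ᵇ-ascent m t w j i j<i ℓ<

countPrefix-≤ᵇ-antitone : ∀ m t {u w : Vec ℕ n} → u ≤B w → countPrefix m (_≤ᵇ t) w ≤ countPrefix m (_≤ᵇ t) u
countPrefix-≤ᵇ-antitone m t ≤B-refl                       = ≤-refl
countPrefix-≤ᵇ-antitone m t (≤B-step {w} u≤w i j ℓ<) =
  ≤-trans (countPrefix-≤ᵇ-step m t w i j ℓ<) (countPrefix-≤ᵇ-antitone m t u≤w)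

-- Shuffles

shuffle : ℕ → ℕ → Vec Bool n → Vec ℕ n
shuffle lo hi []           = []
shuffle lo hi (true  ∷ bs) = lo ∷ shuffle (suc lo) hi bs
shuffle lo hi (false ∷ bs) = hi ∷ shuffle lo (suc hi) bs

shuffle-lookup-true : ∀ lo hi (bs : Vec Bool n) i → lookup bs i ≡ true →
                      lookup (shuffle lo hi bs) i ≡ lo + countPrefix (toℕ i) id bs
shuffle-lookup-true lo hi (true  ∷ bs) zero    _   = sym (+-identityʳ lo)
shuffle-lookup-true lo hi (true  ∷ bs) (suc i) bsᵢ = trans (shuffle-lookup-true (suc lo) hi bs i bsᵢ) (sym (+-suc lo _))
shuffle-lookup-true lo hi (false ∷ bs) (suc i) bsᵢ = shuffle-lookup-true lo (suc hi) bs i bsᵢ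

shuffle-lookup-false : ∀ lo hi (bs : Vec Bool n) i → lookup bs i ≡ false →
                       lookup (shuffle lo hi bs) i ≡ hi + countPrefix (toℕ i) not bs
shuffle-lookup-false lo hi (false ∷ bs) zero    _   = sym (+-identityʳ hi)
shuffle-lookup-false lo hi (false ∷ bs) (suc i) bsᵢ = trans (shuffle-lookup-false lo (suc hi) bs i bsᵢ) (sym (+-suc hi _))
shuffle-lookup-false lo hi (true  ∷ bs) (suc i) bsᵢ = shuffle-lookup-false (suc lo) hi bs i bsᵢ

ranks≡shuffle : ∀ t (low high : Fin n → Bool) → (∀ k → high k ≡ not (low k)) →
  tabulate (λ i → if low i then countᵇ (λ k → (toℕ k <ᵇ suc (toℕ i)) ∧ low k) (allFin n)
                           else t + countᵇ (λ k → (toℕ k <ᵇ suc (toℕ i)) ∧ high k) (allFin n))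
  ≡ shuffle 1 (suc t) (tabulate low)
ranks≡shuffle {n} t low high high≡¬low = lookup-ext λ i → trans (lookup∘tabulate _ i) (entry i)
  where
  bs : Vec Bool n
  bs = tabulate low
  rank≡ : ∀ (Q : Fin n → Bool) (P : Bool → Bool) → (∀ k → Q k ≡ P (low k)) → ∀ i →
          countᵇ (λ k → (toℕ k <ᵇ suc (toℕ i)) ∧ Q k) (allFin n) ≡ countPrefix (toℕ i) P bs + 𝟙 (P (low i))
  rank≡ Q P Q≡P∘low i = begin
    countᵇ (λ k → below k ∧ Q k) (allFin n)      ≡⟨ countᵇ-allFin (λ k → below k ∧ Q k) ⟩
    count (λ k → below k ∧ Q k)                  ≡⟨ count-cong (λ k → cong (below k ∧_) (Q≡P∘low k)) ⟩
    count (λ k → below k ∧ P (low k))            ≡⟨ count-<-tabulate (suc (toℕ i)) P low ⟩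
    countPrefix (suc (toℕ i)) P bs               ≡⟨ countPrefix-suc P bs i ⟩
    countPrefix (toℕ i) P bs + 𝟙 (P (lookup bs i))
      ≡⟨ cong (λ b → countPrefix (toℕ i) P bs + 𝟙 (P b)) (lookup∘tabulate low i) ⟩
    countPrefix (toℕ i) P bs + 𝟙 (P (low i))    ∎
    where
    open ≡-Reasoning
    below : Fin n → Bool
    below k = toℕ k <ᵇ suc (toℕ i)
  bsᵢ≡lowᵢ : ∀ i → lookup bs i ≡ low i
  bsᵢ≡lowᵢ = lookup∘tabulate low
  entry : ∀ i → (if low i then countᵇ (λ k → (toℕ k <ᵇ suc (toℕ i)) ∧ low k) (allFin n)
                           else t + countᵇ (λ k → (toℕ k <ᵇ suc (toℕ i)) ∧ high k) (allFin n))
                ≡ lookup (shuffle 1 (suc t) bs) i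
  entry i with low i in lowᵢ
  ... | true  = begin
    countᵇ (λ k → (toℕ k <ᵇ suc (toℕ i)) ∧ low k) (allFin n) ≡⟨ rank≡ low id (λ _ → refl) i ⟩
    countPrefix (toℕ i) id bs + 𝟙 (low i)                    ≡⟨ cong (λ b → countPrefix (toℕ i) id bs + 𝟙 b) lowᵢ ⟩
    countPrefix (toℕ i) id bs + 1                            ≡⟨ +-comm _ 1 ⟩
    1 + countPrefix (toℕ i) id bs
      ≡⟨ shuffle-lookup-true 1 (suc t) bs i (trans (bsᵢ≡lowᵢ i) lowᵢ) ⟨
    lookup (shuffle 1 (suc t) bs) i                          ∎
    where open ≡-Reasoning
  ... | false = begin
    t + countᵇ (λ k → (toℕ k <ᵇ suc (toℕ i)) ∧ high k) (allFin n) ≡⟨ cong (t +_) (rank≡ high not high≡¬low i) ⟩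
    t + (countPrefix (toℕ i) not bs + 𝟙 (not (low i)))
      ≡⟨ cong (λ b → t + (countPrefix (toℕ i) not bs + 𝟙 (not b))) lowᵢ ⟩
    t + (countPrefix (toℕ i) not bs + 1)                          ≡⟨ trans (cong (t +_) (+-comm _ 1)) (+-suc t _) ⟩
    suc t + countPrefix (toℕ i) not bs
      ≡⟨ shuffle-lookup-false 1 (suc t) bs i (trans (bsᵢ≡lowᵢ i) lowᵢ) ⟨
    lookup (shuffle 1 (suc t) bs) i                               ∎
    where open ≡-Reasoning

countPrefix-≤ᵇ-shuffle : ∀ m t lo hi (bs : Vec Bool n) → lo + countAll id bs ≤ suc t → t < hi →
                         countPrefix m (_≤ᵇ t) (shuffle lo hi bs) ≡ countPrefix m id bs
countPrefix-≤ᵇ-shuffle zero    t lo hi bs           _       _    = refl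
countPrefix-≤ᵇ-shuffle (suc m) t lo hi []           _       _    = refl
countPrefix-≤ᵇ-shuffle (suc m) t lo hi (true  ∷ bs) bounded t<hi = cong₂ _+_
  (cong 𝟙 (T⇒≡true (≤⇒≤ᵇ (≤-pred (≤-trans (s≤s (m≤m+n lo _)) (subst (_≤ suc t) (+-suc lo _) bounded))))))
  (countPrefix-≤ᵇ-shuffle m t (suc lo) hi bs (subst (_≤ suc t) (+-suc lo _) bounded) t<hi)
countPrefix-≤ᵇ-shuffle (suc m) t lo hi (false ∷ bs) bounded t<hi = cong₂ _+_
  (cong 𝟙 (¬T⇒≡false (λ hi≤t → <⇒≱ t<hi (≤ᵇ⇒≤ hi t hi≤t))))
  (countPrefix-≤ᵇ-shuffle m t lo (suc hi) bs bounded (m≤n⇒m≤1+n t<hi))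

data _⇝_ : ∀ {n} → Vec Bool n → Vec Bool n → Set where
  here  : (bs : Vec Bool n) → (true ∷ false ∷ bs) ⇝ (false ∷ true ∷ bs)
  there : (b : Bool) {bs bs′ : Vec Bool n} → bs ⇝ bs′ → (b ∷ bs) ⇝ (b ∷ bs′)

source target : {bs bs′ : Vec Bool n} → bs ⇝ bs′ → Fin n
source (here _)    = zero
source (there _ s) = suc (source s)
target (here _)    = suc zero
target (there _ s) = suc (target s)

target≡suc-source : {bs bs′ : Vec Bool n} (s : bs ⇝ bs′) → toℕ (target s) ≡ suc (toℕ (source s))
target≡suc-source (here _)    = refl
target≡suc-source (there _ s) = cong suc (target≡suc-source s)

shuffle-⇝ : ∀ lo hi {bs bs′ : Vec Bool n} (s : bs ⇝ bs′) →
            shuffle lo hi bs′ ≡ shuffle lo hi bs ·⟨ source s , target s ⟩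
shuffle-⇝ lo hi (here bs)         = sym (·⟨zero,suc⟩ lo (hi ∷ shuffle (suc lo) (suc hi) bs) zero)
shuffle-⇝ lo hi (there true  s) = trans (cong (lo ∷_) (shuffle-⇝ (suc lo) hi s)) (sym (·⟨suc,suc⟩ lo _ _ _))
shuffle-⇝ lo hi (there false s) = trans (cong (hi ∷_) (shuffle-⇝ lo (suc hi) s)) (sym (·⟨suc,suc⟩ hi _ _ _))

shuffle-⇝-descent : ∀ lo hi {bs bs′ : Vec Bool n} (s : bs ⇝ bs′) → lo + countAll id bs′ ≤ hi →
                    lookup (shuffle lo hi bs′) (target s) < lookup (shuffle lo hi bs′) (source s)
shuffle-⇝-descent lo hi (here bs)       lo+c≤hi = <-≤-trans (m<m+n lo z<s) lo+c≤hi
shuffle-⇝-descent lo hi (there true  s) lo+c≤hi = shuffle-⇝-descent (suc lo) hi s (subst (_≤ hi) (+-suc lo _) lo+c≤hi)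
shuffle-⇝-descent lo hi (there false s) lo+c≤hi = shuffle-⇝-descent lo (suc hi) s (m≤n⇒m≤1+n lo+c≤hi)

countPrefix-⇝ : ∀ m {bs bs′ : Vec Bool n} (s : bs ⇝ bs′) → m ≢ toℕ (target s) →
                countPrefix m id bs′ ≡ countPrefix m id bs
countPrefix-⇝ zero                _           _    = refl
countPrefix-⇝ (suc zero)          (here bs)   m≢1  = ⊥-elim (m≢1 refl)
countPrefix-⇝ (suc (suc m))       (here bs)   _    = refl
countPrefix-⇝ (suc m)             (there b s) m≢j  = cong (𝟙 b +_) (countPrefix-⇝ m s (m≢j ∘ cong suc))

countPrefix-⇝-target : {bs bs′ : Vec Bool n} (s : bs ⇝ bs′) →
                       suc (countPrefix (toℕ (target s)) id bs′) ≡ countPrefix (toℕ (target s)) id bs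
countPrefix-⇝-target (here bs)   = refl
countPrefix-⇝-target (there b s) = trans (sym (+-suc (𝟙 b) _)) (cong (𝟙 b +_) (countPrefix-⇝-target s))

countPrefix-⇝-≤ : ∀ m {bs bs′ : Vec Bool n} (s : bs ⇝ bs′) → countPrefix m id bs′ ≤ countPrefix m id bs
countPrefix-⇝-≤ m s with m ≟ toℕ (target s)
... | yes refl = ≤-trans (n≤1+n _) (≤-reflexive (countPrefix-⇝-target s))
... | no  m≢j  = ≤-reflexive (countPrefix-⇝ m s m≢j)

countAll-⇝ : {bs bs′ : Vec Bool n} (s : bs ⇝ bs′) → countAll id bs′ ≡ countAll id bs
countAll-⇝ s = countPrefix-⇝ _ s (<⇒≢ (Fin.toℕ<n (target s)) ∘ sym)

shuffle-⇝-≤B : ∀ lo hi {bs bs′ : Vec Bool n} (s : bs ⇝ bs′) → lo + countAll id bs ≤ hi →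
               shuffle lo hi bs ≤B shuffle lo hi bs′
shuffle-⇝-≤B {n} lo hi {bs} {bs′} s lo+c≤hi =
  subst (shuffle lo hi bs ≤B_) (sym (shuffle-⇝ lo hi s)) (≤B-step ≤B-refl i j ℓ<)
  where
  open ≤-Reasoning
  i j : Fin n
  i = source s
  j = target s
  u u′ : Vec ℕ n
  u  = shuffle lo hi bs
  u′ = shuffle lo hi bs′
  u′·ij≡u : u′ ·⟨ i , j ⟩ ≡ u
  u′·ij≡u = trans (cong (_·⟨ i , j ⟩) (shuffle-⇝ lo hi s)) (·⟨⟩-involutive u i j)
  ℓ< : ℓ u < ℓ (u ·⟨ i , j ⟩)
  ℓ< = begin-strict
    ℓ u                         ≡⟨ ℓ≡inversions u ⟩
    inversions u                ≡⟨ cong inversions u′·ij≡u ⟨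
    inversions (u′ ·⟨ i , j ⟩)  <⟨ inversions-swap-< u′ i j (≤-reflexive (sym (target≡suc-source s)))
                                     (shuffle-⇝-descent lo hi s (subst (λ c → lo + c ≤ hi) (sym (countAll-⇝ s)) lo+c≤hi)) ⟩
    inversions u′               ≡⟨ ℓ≡inversions u′ ⟨
    ℓ u′                        ≡⟨ cong ℓ (shuffle-⇝ lo hi s) ⟩
    ℓ (u ·⟨ i , j ⟩)            ∎

area : Vec Bool n → ℕ
area {n} bs = sum λ (m : Fin n) → countPrefix (toℕ m) id bs

area-⇝ : {bs bs′ : Vec Bool n} (s : bs ⇝ bs′) → area bs′ < area bs
area-⇝ s = sum-mono-< (λ m → countPrefix-⇝-≤ (toℕ m) s) (target s) (≤-reflexive (countPrefix-⇝-target s))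

_≼_ : Vec Bool n → Vec Bool n → Set
cs ≼ bs = ∀ m → countPrefix m id cs ≤ countPrefix m id bs

≼-∷ : ∀ b {bs cs : Vec Bool n} → cs ≼ bs → (b ∷ cs) ≼ (b ∷ bs)
≼-∷ b cs≼bs zero    = z≤n
≼-∷ b cs≼bs (suc m) = +-monoʳ-≤ (𝟙 b) (cs≼bs m)

∷-≼ : ∀ b {bs cs : Vec Bool n} → (b ∷ cs) ≼ (b ∷ bs) → cs ≼ bs
∷-≼ b cs≼bs m = +-cancelˡ-≤ (𝟙 b) _ _ (cs≼bs (suc m))

≼-⇝ : {bs bs′ cs : Vec Bool n} (s : bs ⇝ bs′) → cs ≼ bs →
      countPrefix (toℕ (target s)) id cs < countPrefix (toℕ (target s)) id bs → cs ≼ bs′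
≼-⇝ {cs = cs} s cs≼bs strict m with m ≟ toℕ (target s)
... | yes refl = ≤-pred (subst (countPrefix m id cs <_) (sym (countPrefix-⇝-target s)) strict)
... | no  m≢j  = subst (countPrefix m id cs ≤_) (sym (countPrefix-⇝ m s m≢j)) (cs≼bs m)

shift-at-run-end : (r : Vec Bool n) → countAll id r < n →
                   Σ[ bs′ ∈ Vec Bool (suc n) ] Σ[ s ∈ (true ∷ r) ⇝ bs′ ]
                     countPrefix (toℕ (target s)) id (true ∷ r) ≡ toℕ (target s)
shift-at-run-end (false ∷ r) _         = false ∷ true ∷ r , here r , refl
shift-at-run-end (true  ∷ r) (s≤s c<n) with shift-at-run-end r c<n
... | bs′ , s , all-true = true ∷ bs′ , there true s , cong suc all-true

shift-toward : {bs cs : Vec Bool n} → cs ≼ bs → countAll id cs ≡ countAll id bs → bs ≢ cs →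
               Σ[ bs′ ∈ Vec Bool n ] (bs ⇝ bs′ × cs ≼ bs′)
shift-toward-∷ : ∀ b {bs cs : Vec Bool n} → (b ∷ cs) ≼ (b ∷ bs) → countAll id (b ∷ cs) ≡ countAll id (b ∷ bs) →
                 (b ∷ bs) ≢ (b ∷ cs) → Σ[ bs′ ∈ Vec Bool (suc n) ] ((b ∷ bs) ⇝ bs′ × (b ∷ cs) ≼ bs′)

shift-toward {bs = []}        {[]}        _     _   bs≢cs = ⊥-elim (bs≢cs refl)
shift-toward {bs = true  ∷ _} {true  ∷ _} cs≼bs tot bs≢cs = shift-toward-∷ true  cs≼bs tot bs≢cs
shift-toward {bs = false ∷ _} {false ∷ _} cs≼bs tot bs≢cs = shift-toward-∷ false cs≼bs tot bs≢cs
shift-toward {bs = false ∷ _} {true  ∷ _} cs≼bs _   _     = ⊥-elim (1+n≰n (cs≼bs 1))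
-- first difference: up to the end of the run of trues starting here, cs has fewer trues than bs
shift-toward {n = suc n} {bs = true ∷ r}  {false ∷ cs} cs≼bs tot _
  with shift-at-run-end r (subst (_≤ n) tot (countPrefix-≤ n id cs))
... | bs′ , s , all-true = bs′ , s , ≼-⇝ s cs≼bs (begin-strict
  countPrefix j id (false ∷ cs)        ≡⟨ cong (λ k → countPrefix k id (false ∷ cs)) (target≡suc-source s) ⟩
  countPrefix (toℕ (source s)) id cs   ≤⟨ countPrefix-≤ _ id cs ⟩
  toℕ (source s)                       <⟨ ≤-reflexive (sym (target≡suc-source s)) ⟩
  j                                    ≡⟨ all-true ⟨
  countPrefix j id (true ∷ r)          ∎)
  where
  open ≤-Reasoning
  j : ℕ
  j = toℕ (target s)

shift-toward-∷ b cs≼bs tot bs≢cs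
  with shift-toward (∷-≼ b cs≼bs) (+-cancelˡ-≡ (𝟙 b) _ _ tot) (bs≢cs ∘ cong (b ∷_))
... | bs′ , s , cs≼bs′ = b ∷ bs′ , there b s , ≼-∷ b cs≼bs′

≼⇒shuffle-≤B : ∀ lo hi {bs cs : Vec Bool n} → lo + countAll id bs ≤ hi →
               cs ≼ bs → countAll id cs ≡ countAll id bs → shuffle lo hi bs ≤B shuffle lo hi cs
≼⇒shuffle-≤B lo hi {bs} = go bs (<-wellFounded (area bs))
  where
  go : ∀ bs {cs} → Acc _<_ (area bs) → lo + countAll id bs ≤ hi →
       cs ≼ bs → countAll id cs ≡ countAll id bs → shuffle lo hi bs ≤B shuffle lo hi cs
  go bs {cs} (acc rec) bounded cs≼bs tot with ≡-dec Bool._≟_ bs cs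
  ... | yes refl = ≤B-refl
  ... | no bs≢cs with shift-toward cs≼bs tot bs≢cs
  ...   | bs′ , s , cs≼bs′ =
    ≤B-trans (shuffle-⇝-≤B lo hi s bounded)
             (go bs′ (rec (area-⇝ s)) (subst (λ c → lo + c ≤ hi) (sym (countAll-⇝ s)) bounded)
                 cs≼bs′ (trans tot (sym (countAll-⇝ s))))

shuffle-≤B⇔≼ : ∀ t (bs cs : Vec Bool n) → countAll id bs ≡ t → countAll id cs ≡ t →
               (shuffle 1 (suc t) bs ≤B shuffle 1 (suc t) cs) ⇔ (cs ≼ bs)
shuffle-≤B⇔≼ t bs cs #bs≡t #cs≡t = mk⇔
  (λ bs≤cs m → subst₂ _≤_ (countPrefix-≤ᵇ-shuffle m t 1 (suc t) cs (≤-reflexive (cong suc #cs≡t)) ≤-refl)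
                          (countPrefix-≤ᵇ-shuffle m t 1 (suc t) bs (≤-reflexive (cong suc #bs≡t)) ≤-refl)
                          (countPrefix-≤ᵇ-antitone m t bs≤cs))
  (λ cs≼bs → ≼⇒shuffle-≤B 1 (suc t) (≤-reflexive (cong suc #bs≡t)) cs≼bs (trans #cs≡t (sym #bs≡t)))

≥-on-[1,n]⇔≼ : (f g : ℕ → ℕ) (bs cs : Vec Bool n) →
               (∀ i → f i + countPrefix i id cs ≡ g i + countPrefix i id bs) → countAll id cs ≡ countAll id bs →
               (∀ i → 1 ≤ i → i ≤ n → f i ≥ g i) ⇔ (cs ≼ bs)
≥-on-[1,n]⇔≼ {n} f g bs cs balanced #cs≡#bs = mk⇔ to from
  where
  to : (∀ i → 1 ≤ i → i ≤ n → f i ≥ g i) → cs ≼ bs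
  to f≥g zero = z≤n
  to f≥g (suc i) with suc i ≤? n
  ... | yes i<n = +-cancelˡ-≤ (g (suc i)) _ _
                    (≤-trans (+-monoˡ-≤ _ (f≥g (suc i) (s≤s z≤n) i<n)) (≤-reflexive (balanced (suc i))))
  ... | no  i≮n = ≤-reflexive (trans (countPrefix-full id cs n≤i) (trans #cs≡#bs (sym (countPrefix-full id bs n≤i))))
    where
    n≤i : n ≤ suc i
    n≤i = <⇒≤ (≰⇒> i≮n)
  from : cs ≼ bs → ∀ i → 1 ≤ i → i ≤ n → f i ≥ g i
  from cs≼bs i _ _ = +-cancelʳ-≤ (countPrefix i id cs) _ _
                       (≤-trans (+-monoʳ-≤ (g i) (cs≼bs i)) (≤-reflexive (sym (balanced i))))

-- Clans

[+a]-[+b]≡[+c]-[+d]⇒a+d≡c+b : ∀ a b c d → ℤ.+ a ℤ.- ℤ.+ b ≡ ℤ.+ c ℤ.- ℤ.+ d → a + d ≡ c + b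
[+a]-[+b]≡[+c]-[+d]⇒a+d≡c+b a b c d eq = ℤ.+-injective (begin
  ℤ.+ a ℤ.+ ℤ.+ d                       ≡⟨ regroup (ℤ.+ a) (ℤ.+ b) (ℤ.+ d) ⟩
  (ℤ.+ a ℤ.- ℤ.+ b) ℤ.+ (ℤ.+ b ℤ.+ ℤ.+ d)   ≡⟨ cong (ℤ._+ (ℤ.+ b ℤ.+ ℤ.+ d)) eq ⟩
  (ℤ.+ c ℤ.- ℤ.+ d) ℤ.+ (ℤ.+ b ℤ.+ ℤ.+ d)   ≡⟨ regroup′ (ℤ.+ c) (ℤ.+ b) (ℤ.+ d) ⟨
  ℤ.+ c ℤ.+ ℤ.+ b                       ∎)
  where
  open ≡-Reasoning
  regroup : ∀ x y z → x ℤ.+ z ≡ (x ℤ.- y) ℤ.+ (y ℤ.+ z)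
  regroup = ℤ-solve-∀
  regroup′ : ∀ x y z → x ℤ.+ y ≡ (x ℤ.- z) ℤ.+ (y ℤ.+ z)
  regroup′ = ℤ-solve-∀

size-from-counts : ∀ {a b l u t t′} → a + l + u ≡ t′ + t → a + t ≡ t′ + b → u ≡ b + l → u ≡ t
size-from-counts {a} {b} {l} {_} {t} {t′} total balance refl = *-cancelˡ-≡ (b + l) t 2 (+-cancelˡ-≡ t′ _ _ (begin
  t′ + 2 * (b + l)          ≡⟨ regroup₁ t′ b l ⟩
  (t′ + b) + l + (b + l)    ≡⟨ cong (λ x → x + l + (b + l)) balance ⟨
  (a + t) + l + (b + l)     ≡⟨ regroup₂ a t l (b + l) ⟩
  (a + l + (b + l)) + t     ≡⟨ cong (_+ t) total ⟩
  t′ + t + t                ≡⟨ regroup₃ t′ t ⟩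
  t′ + 2 * t                ∎))
  where
  open ≡-Reasoning
  regroup₁ : ∀ t′ b l → t′ + 2 * (b + l) ≡ t′ + b + l + (b + l)
  regroup₁ = solve-∀
  regroup₂ : ∀ a t l u → a + t + l + u ≡ a + l + u + t
  regroup₂ = solve-∀
  regroup₃ : ∀ t′ t → t′ + t + t ≡ t′ + 2 * t
  regroup₃ = solve-∀

data OneHot : Bool → Bool → Bool → Bool → Set where
  at₁ : OneHot true  false false false
  at₂ : OneHot false true  false false
  at₃ : OneHot false false true  false
  at₄ : OneHot false false false true

OneHot-swap : ∀ {a b l r} → OneHot a b l r → OneHot b a l r
OneHot-swap at₁ = at₂
OneHot-swap at₂ = at₁
OneHot-swap at₃ = at₃
OneHot-swap at₄ = at₄

OneHot-∨ : ∀ {a b l r} → OneHot a b l r → 𝟙 (b ∨ l) ≡ 𝟙 b + 𝟙 l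
OneHot-∨ at₁ = refl
OneHot-∨ at₂ = refl
OneHot-∨ at₃ = refl
OneHot-∨ at₄ = refl

OneHot-not : ∀ {a b l r} → OneHot a b l r → a ∨ r ≡ not (b ∨ l)
OneHot-not at₁ = refl
OneHot-not at₂ = refl
OneHot-not at₃ = refl
OneHot-not at₄ = refl

OneHot-partition : ∀ x {a b l r} → OneHot a b l r → 𝟙 (x ∧ a) + 𝟙 (r ∧ x) + 𝟙 (x ∧ (b ∨ l)) ≡ 𝟙 x
OneHot-partition false at₁ = refl
OneHot-partition false at₂ = refl
OneHot-partition false at₃ = refl
OneHot-partition false at₄ = refl
OneHot-partition true  at₁ = refl
OneHot-partition true  at₂ = refl
OneHot-partition true  at₃ = refl
OneHot-partition true  at₄ = refl

OneHot-total : ∀ {a b l r} → OneHot a b l r → 𝟙 a + 𝟙 r + 𝟙 (b ∨ l) ≡ 1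
OneHot-total at₁ = refl
OneHot-total at₂ = refl
OneHot-total at₃ = refl
OneHot-total at₄ = refl

module _ {p q : ℕ} (γ : Clan p q) where
  open Clan γ

  nodeKind : ∀ k → OneHot (isPlus γ k) (isMinus γ k) (isLeft γ k) (isRight γ k)
  nodeKind k with <-cmp (toℕ k) (toℕ (σ k))
  ... | tri< k<σk _ _
    rewrite ¬T⇒≡false (<⇒≢ k<σk ∘ sym ∘ ≡ᵇ⇒≡ (toℕ (σ k)) (toℕ k))
          | T⇒≡true (<⇒<ᵇ k<σk)
          | ¬T⇒≡false (<⇒≯ k<σk ∘ <ᵇ⇒< (toℕ (σ k)) (toℕ k)) = at₃
  ... | tri> _ _ σk<k
    rewrite ¬T⇒≡false (<⇒≢ σk<k ∘ ≡ᵇ⇒≡ (toℕ (σ k)) (toℕ k))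
          | ¬T⇒≡false (<⇒≯ σk<k ∘ <ᵇ⇒< (toℕ k) (toℕ (σ k)))
          | T⇒≡true (<⇒<ᵇ σk<k) = at₄
  ... | tri≈ _ k≡σk _
    rewrite T⇒≡true (≡⇒≡ᵇ (toℕ (σ k)) (toℕ k) (sym k≡σk))
          | ¬T⇒≡false (<-irrefl k≡σk ∘ <ᵇ⇒< (toℕ k) (toℕ (σ k)))
          | ¬T⇒≡false (<-irrefl (sym k≡σk) ∘ <ᵇ⇒< (toℕ (σ k)) (toℕ k))
    with sgn k
  ...   | true  = at₁
  ...   | false = at₂

  isRight∘σ : ∀ k → isRight γ (σ k) ≡ isLeft γ k
  isRight∘σ k = cong (λ j → toℕ j <ᵇ toℕ (σ k)) (invol k)

  count-isRight : count (isRight γ) ≡ count (isLeft γ)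
  count-isRight = trans (sym (count-permute σ σ invol invol (isRight γ))) (count-cong isRight∘σ)

  arcs-within : ∀ i → countᵇ (λ k → isLeft γ k ∧ inFirst γ i k ∧ inFirst γ i (σ k)) (allFin (p + q))
                    ≡ count (λ k → isRight γ k ∧ inFirst γ i k)
  arcs-within i = begin
    countᵇ (λ k → isLeft γ k ∧ inFirst γ i k ∧ inFirst γ i (σ k)) (allFin (p + q))
      ≡⟨ countᵇ-allFin (λ k → isLeft γ k ∧ inFirst γ i k ∧ inFirst γ i (σ k)) ⟩
    count (λ k → isLeft γ k ∧ inFirst γ i k ∧ inFirst γ i (σ k))
      ≡⟨ count-cong arc-within ⟩
    count (λ k → isRight γ (σ k) ∧ inFirst γ i (σ k))
      ≡⟨ count-permute σ σ invol invol (λ k → isRight γ k ∧ inFirst γ i k) ⟩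
    count (λ k → isRight γ k ∧ inFirst γ i k) ∎
    where
    open ≡-Reasoning
    -- an arc lies among the first i nodes as soon as its right endpoint does
    arc-within : ∀ k → isLeft γ k ∧ inFirst γ i k ∧ inFirst γ i (σ k) ≡ isRight γ (σ k) ∧ inFirst γ i (σ k)
    arc-within k rewrite isRight∘σ k with isLeft γ k in k<σk | inFirst γ i k in k<i
    ... | false | _     = refl
    ... | true  | true  = refl
    ... | true  | false = sym (¬T⇒≡false λ σk<i → subst T k<i (<⇒<ᵇ (<-trans (<ᵇ⇒< (toℕ k) (toℕ (σ k)) k<ᵇσk)
                                                                        (<ᵇ⇒< (toℕ (σ k)) i σk<i))))
      where
      k<ᵇσk : T (toℕ k <ᵇ toℕ (σ k))
      k<ᵇσk = subst T (sym k<σk) tt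

-- s = true describes the pair (γ(i;+), u_γ) and s = false the pair (γ(i;−), v_γ)
module _ {p q : ℕ} where

  size : Bool → ℕ
  size true  = q
  size false = p

  sign : Bool → Clan p q → Fin (p + q) → Bool
  sign true  = isPlus
  sign false = isMinus

  lowSet : Bool → Clan p q → Fin (p + q) → Bool
  lowSet s γ k = sign (not s) γ k ∨ isLeft γ k

  signCount : Bool → Clan p q → ℕ → ℕ
  signCount s γ i = countᵇ (λ k → inFirst γ i k ∧ sign s γ k) (allFin (p + q))
                  + countᵇ (λ k → isLeft γ k ∧ inFirst γ i k ∧ inFirst γ i (Clan.σ γ k)) (allFin (p + q))

  signPerm : Bool → Clan p q → Vec ℕ (p + q)
  signPerm s γ = tabulate λ i → if lowSet s γ i then rank γ (lowSet s γ) i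
                                  else size s + rank γ (λ k → sign s γ k ∨ isRight γ k) i

  signKind : ∀ s γ k → OneHot (sign s γ k) (sign (not s) γ k) (isLeft γ k) (isRight γ k)
  signKind true  γ k = nodeKind γ k
  signKind false γ k = OneHot-swap (nodeKind γ k)

  size-sum : ∀ s → size (not s) + size s ≡ p + q
  size-sum true  = refl
  size-sum false = +-comm q p

  signBalance : ∀ s γ → count (sign s γ) + size s ≡ size (not s) + count (sign (not s) γ)
  signBalance true  γ = [+a]-[+b]≡[+c]-[+d]⇒a+d≡c+b _ _ p q
    (subst₂ (λ a b → ℤ.+ a ℤ.- ℤ.+ b ≡ ℤ.+ p ℤ.- ℤ.+ q)
            (countᵇ-allFin (isPlus γ)) (countᵇ-allFin (isMinus γ)) (Clan.balance γ))
  signBalance false γ = trans (+-comm _ p) (trans (sym (signBalance true γ)) (+-comm _ q))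

  signPerm-shuffle : ∀ s γ → signPerm s γ ≡ shuffle 1 (suc (size s)) (tabulate (lowSet s γ))
  signPerm-shuffle s γ =
    ranks≡shuffle (size s) (lowSet s γ) (λ k → sign s γ k ∨ isRight γ k) (OneHot-not ∘ signKind s γ)

  countAll-lowSet : ∀ s γ → countAll id (tabulate (lowSet s γ)) ≡ size s
  countAll-lowSet s γ = trans (countAll-tabulate id (lowSet s γ))
                              (size-from-counts total (signBalance s γ) (count-+ (OneHot-∨ ∘ signKind s γ)))
    where
    total : count (sign s γ) + count (isLeft γ) + count (lowSet s γ) ≡ size (not s) + size s
    total = begin
      count (sign s γ) + count (isLeft γ) + count (lowSet s γ)
        ≡⟨ cong (λ c → count (sign s γ) + c + count (lowSet s γ)) (count-isRight γ) ⟨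
      count (sign s γ) + count (isRight γ) + count (lowSet s γ) ≡⟨ count-+₃ (OneHot-total ∘ signKind s γ) ⟩
      count {p + q} (λ _ → true)                                ≡⟨ count-true ⟩
      p + q                                                     ≡⟨ size-sum s ⟨
      size (not s) + size s                                     ∎
      where open ≡-Reasoning

  signCount-lowSet : ∀ s γ i →
                     signCount s γ i + countPrefix i id (tabulate (lowSet s γ)) ≡ count {p + q} (λ k → toℕ k <ᵇ i)
  signCount-lowSet s γ i = begin
    signCount s γ i + countPrefix i id low                ≡⟨ cong₂ (λ x y → x + y + countPrefix i id low)
                                                                    (countᵇ-allFin (λ k → inFirst γ i k ∧ sign s γ k))
                                                                    (arcs-within γ i) ⟩
    signed + rights + countPrefix i id low                ≡⟨ cong (signed + rights +_) (count-<-tabulate i id (lowSet s γ)) ⟨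
    signed + rights + count (λ k → inFirst γ i k ∧ lowSet s γ k)
      ≡⟨ count-+₃ (λ k → OneHot-partition (inFirst γ i k) (signKind s γ k)) ⟩
    count {p + q} (λ k → toℕ k <ᵇ i)                      ∎
    where
    open ≡-Reasoning
    low : Vec Bool (p + q)
    low = tabulate (lowSet s γ)
    signed rights : ℕ
    signed = count (λ k → inFirst γ i k ∧ sign s γ k)
    rights = count (λ k → isRight γ k ∧ inFirst γ i k)

  signCount-≥⇔signPerm-≤B : ∀ s (γ τ : Clan p q) →
    ((∀ i → 1 ≤ i → i ≤ p + q → signCount s γ i ≥ signCount s τ i) ⇔ (signPerm s τ ≤B signPerm s γ))
  signCount-≥⇔signPerm-≤B s γ τ =
    subst₂ (λ u w → Dominates ⇔ (u ≤B w)) (sym (signPerm-shuffle s τ)) (sym (signPerm-shuffle s γ))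
           (⇔-sym shuffles-≤B⇔≼ ⇔-∘ dominates⇔≼)
    where
    Dominates : Set
    Dominates = ∀ i → 1 ≤ i → i ≤ p + q → signCount s γ i ≥ signCount s τ i
    dominates⇔≼ : Dominates ⇔ (tabulate (lowSet s γ) ≼ tabulate (lowSet s τ))
    dominates⇔≼ = ≥-on-[1,n]⇔≼ (signCount s γ) (signCount s τ) (tabulate (lowSet s τ)) (tabulate (lowSet s γ))
                    (λ i → trans (signCount-lowSet s γ i) (sym (signCount-lowSet s τ i)))
                    (trans (countAll-lowSet s γ) (sym (countAll-lowSet s τ)))
    shuffles-≤B⇔≼ : (shuffle 1 (suc (size s)) (tabulate (lowSet s τ)) ≤B shuffle 1 (suc (size s)) (tabulate (lowSet s γ)))
                    ⇔ (tabulate (lowSet s γ) ≼ tabulate (lowSet s τ))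
    shuffles-≤B⇔≼ = shuffle-≤B⇔≼ (size s) (tabulate (lowSet s τ)) (tabulate (lowSet s γ))
                                 (countAll-lowSet s τ) (countAll-lowSet s γ)

lemma5p5 : (p q : ℕ) → 1 ≤ p → 1 ≤ q → (γ τ : Clan p q) →
    (((i : ℕ) → 1 ≤ i → i ≤ p + q → γ⁺ γ i ≥ γ⁺ τ i) ⇔ (uγ τ ≤B uγ γ))
    × (((i : ℕ) → 1 ≤ i → i ≤ p + q → γ⁻ γ i ≥ γ⁻ τ i) ⇔ (vγ τ ≤B vγ γ))
lemma5p5 p q _ _ γ τ = signCount-≥⇔signPerm-≤B true γ τ , signCount-≥⇔signPerm-≤B false γ τ
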